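{- Let $G$ be an additive group of order $v$. If there exists a Fano Kaleidoscopic Difference Family FKDF$(v)$ in $G$, then there exists a $G$-regular Fano Kaleidoscope FK$(v)$.
   Context: For a subset $B$ of an additive group $G$, $\Delta B$ is the multiset of differences $x-y$ over ordered pairs of distinct $x,y\in B$. A $(G,k,\lambda)$ difference family is a collection of $k$-subsets of $G$ whose multiset union of difference lists covers each nonzero element of $G$ exactly $\lambda$ times. For an ordered 7-tuple $B=(b_0,\dots,b_6)$, its $i$-th line is $\ell_i(B)=\{b_i,b_{i+1},b_{i+3}\}$ (indices mod 7). An FKDF$(v)$ in $G$ ($v=6t+1$) is a $(G,7,7)$ difference family $\{B_1,\dots,B_t\}$ together with an ordering of the points of each block such that for each $j\in\{0,\dots,6\}$ the set $\{\ell_j(B_i):1\le i\le t\}$ is a $(G,3,1)$ difference family. A Fano Kaleidoscope FK$(v)$ is a set $\mathcal F$ of Fano planes (2-$(7,3,1)$ designs) with points in a $v$-set $\mathcal V$, the seven lines of each plane colored with seven distinct colors $c_0,\dots,c_6$, such that for any two distinct points $x,y$ and any color $c_i$ exactly one plane of $\mathcal F$ has its $c_i$-colored line containing $x,y$. It is $G$-regular if $G$ acts sharply transitively on $\mathcal V$ (identified with $G$) and the collection of colored planes is invariant under translations by $G$. -}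

module Defs where

open import Data.Nat using (ℕ; zero; suc; _+_)
open import Data.Nat.DivMod using (_mod_)
open import Data.Fin using (Fin; toℕ) renaming (zero to fz; suc to fs)
open import Data.Fin.Properties using (any?) renaming (_≟_ to _≟ᶠ_)
open import Data.Bool using (if_then_else_)
open import Data.Product using (Σ; ∃-syntax; _×_)
open import Relation.Nullary using (Dec; ¬_; _×-dec_)
open import Relation.Nullary.Decidable using (isYes; ¬?)
open import Relation.Binary.PropositionalEquality using (_≡_)
open import Function.Definitions using (Injective)
open import Function.Bundles using (_⇔_)
open import Algebra.Core using (Op₁; Op₂)
open import Algebra.Structures using (IsAbelianGroup)

-- A finite additive (abelian) group of order v, realised on the carrier Fin v
-- (every group of order v is isomorphic to one of these).
record FiniteAdditiveGroup (v : ℕ) : Set where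
  field
    _+ᴳ_ : Op₂ (Fin v)
    0ᴳ : Fin v
    -ᴳ_ : Op₁ (Fin v)
    isAbelianGroup : IsAbelianGroup _≡_ _+ᴳ_ 0ᴳ -ᴳ_

sumF : ∀ {n} → (Fin n → ℕ) → ℕ
sumF {zero} f = 0
sumF {suc n} f = f fz + sumF (λ i → f (fs i))

𝟙 : ∀ {p} {P : Set p} → Dec P → ℕ
𝟙 d = if isYes d then 1 else 0

shift7 : Fin 7 → ℕ → Fin 7
shift7 j c = (toℕ j + c) mod 7

module _ {v : ℕ} (G : FiniteAdditiveGroup v) where
  open FiniteAdditiveGroup G

  _-ᴳ_ : Fin v → Fin v → Fin v
  x -ᴳ y = x +ᴳ (-ᴳ y)

  -- A k-subset of G is given as an injective k-tuple B.
  -- Multiplicity of g in the multiset ΔB = {B a - B b : a ≠ b}.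
  Δmult : ∀ {k} → (Fin k → Fin v) → Fin v → ℕ
  Δmult B g = sumF λ a → sumF λ b → 𝟙 (¬? (a ≟ᶠ b) ×-dec ((B a -ᴳ B b) ≟ᶠ g))

  IsDifferenceFamily : (k lam : ℕ) {t : ℕ} → (Fin t → Fin k → Fin v) → Set
  IsDifferenceFamily k lam {t} B =
    (∀ i → Injective _≡_ _≡_ (B i)) ×
    (∀ g → ¬ g ≡ 0ᴳ → sumF (λ i → Δmult (B i) g) ≡ lam)

  ℓ : (Fin 7 → Fin v) → Fin 7 → Fin 3 → Fin v
  ℓ B j fz = B j
  ℓ B j (fs fz) = B (shift7 j 1)
  ℓ B j (fs (fs fz)) = B (shift7 j 3)

  record FKDF (t : ℕ) : Set where
    field
      blocks : Fin t → Fin 7 → Fin v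
      isDF : IsDifferenceFamily 7 7 blocks
      linesDF : ∀ j → IsDifferenceFamily 3 1 (λ i → ℓ (blocks i) j)

  -- A Fano plane with points in G and its 7 lines coloured by Fin 7:
  -- 7 distinct points, line c (colour c) is a 3-subset of them, and every
  -- pair of distinct points lies in exactly one line (2-(7,3,1) design).
  record ColouredFanoPlane : Set where
    field
      point : Fin 7 → Fin v
      point-inj : Injective _≡_ _≡_ point
      line : Fin 7 → Fin 3 → Fin 7
      line-inj : ∀ c → Injective _≡_ _≡_ (line c)
      design : ∀ a b → ¬ a ≡ b →
        sumF (λ c → 𝟙 (any? (λ s → line c s ≟ᶠ a) ×-dec any? (λ s → line c s ≟ᶠ b))) ≡ 1

  OnLine : ColouredFanoPlane → Fin 7 → Fin v → Set
  OnLine P c x = Σ (Fin 3) λ s → point (line c s) ≡ x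
    where open ColouredFanoPlane P

  onLine? : ∀ P c x → Dec (OnLine P c x)
  onLine? P c x = any? λ s → point (line c s) ≟ᶠ x
    where open ColouredFanoPlane P

  -- G-regular Fano Kaleidoscope on V = G (G acting by translation)
  record GRegularFK : Set where
    field
      m : ℕ
      planes : Fin m → ColouredFanoPlane
      kaleidoscope : ∀ x y → ¬ x ≡ y → ∀ c →
        sumF (λ i → 𝟙 (onLine? (planes i) c x ×-dec onLine? (planes i) c y)) ≡ 1
      invariant : ∀ i g → ∃[ j ] (∀ c x →
        OnLine (planes i) c x ⇔ OnLine (planes j) c (x +ᴳ g))

-- Construction: the planes are all translates B_i + g of the ordered
-- base blocks, each carrying the fixed Fano plane on the positions
-- Fin 7 whose c-th line is {c, c+1, c+3} (mod 7).  Its c-coloured line is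
-- then the translate ℓ_c(B_i) + g of the c-th line of B_i.
--
-- The theorem then follows: covering each pair once in colour c is the
-- development lemma for the c-th line family, and translating a plane
-- B_i + g by h gives the plane B_i + (g + h).
module Submission where

open import Defs
open import Level using (Level; 0ℓ)
open import Data.Nat using (ℕ; zero; suc; _+_; _*_)
open import Data.Nat.Properties using (+-*-semiring; +-identityʳ; +-assoc)
  renaming (_≟_ to _≟ℕ_)
open import Data.Fin using (Fin; _↑ˡ_; _↑ʳ_; combine; remQuot; punchIn)
  renaming (zero to fz; suc to fs)
open import Data.Fin.Properties using (any?; all?; remQuot-combine; punchInᵢ≢i)
  renaming (_≟_ to _≟ᶠ_)
open import Data.Product using (∃-syntax; _×_; _,_; proj₁; proj₂; uncurry)
open import Data.Empty using (⊥-elim)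
open import Relation.Nullary using (Dec; yes; no; ¬_; _×-dec_; ¬?; _→-dec_)
open import Relation.Nullary.Decidable using (from-yes)
open import Relation.Binary.PropositionalEquality
open import Function.Base using (_∘_; flip)
open import Function.Bundles using (_⇔_; mk⇔; Equivalence)
open import Function.Definitions using (Injective)
open import Algebra.Bundles using (AbelianGroup; Group)
import Algebra.Properties.Group as GroupProperties
open import Algebra.Properties.Semiring.Sum +-*-semiring
  using (sum; sum-cong-≗; ∑-comm; *-distribˡ-sum; *-distribʳ-sum; sum-remove)

open ≡-Reasoning

sumF-cong : ∀ {n} {f g : Fin n → ℕ} → (∀ i → f i ≡ g i) → sumF f ≡ sumF g
sumF-cong {zero} e = refl
sumF-cong {suc n} e = cong₂ _+_ (e fz) (sumF-cong (e ∘ fs))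

sumF-zero : ∀ {n} {f : Fin n → ℕ} → (∀ i → f i ≡ 0) → sumF f ≡ 0
sumF-zero {zero} e = refl
sumF-zero {suc n} e = cong₂ _+_ (e fz) (sumF-zero (e ∘ fs))

-- sumF is the library's summation over the semiring ℕ, whose algebraic
-- laws (commutation of sums, distributivity) we import through this.
sumF≡sum : ∀ {n} (f : Fin n → ℕ) → sumF f ≡ sum f
sumF≡sum {zero} f = refl
sumF≡sum {suc n} f = cong (f fz +_) (sumF≡sum (f ∘ fs))

sumF²≡sum² : ∀ {m n} (h : Fin m → Fin n → ℕ) →
  sumF (λ a → sumF (h a)) ≡ sum (λ a → sum (h a))
sumF²≡sum² h = trans (sumF≡sum (λ a → sumF (h a))) (sum-cong-≗ (λ a → sumF≡sum (h a)))

sumF-comm : ∀ {m n} (h : Fin m → Fin n → ℕ) →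
  sumF (λ a → sumF (h a)) ≡ sumF (λ b → sumF (λ a → h a b))
sumF-comm h = begin
  sumF (λ a → sumF (h a))          ≡⟨ sumF²≡sum² h ⟩
  sum (λ a → sum (h a))            ≡⟨ ∑-comm h ⟩
  sum (λ b → sum (λ a → h a b))    ≡⟨ sumF²≡sum² (flip h) ⟨
  sumF (λ b → sumF (λ a → h a b))  ∎

sumF-*-sumF : ∀ {m n} (f : Fin m → ℕ) (g : Fin n → ℕ) →
  sumF f * sumF g ≡ sumF (λ a → sumF (λ b → f a * g b))
sumF-*-sumF f g = begin
  sumF f * sumF g                    ≡⟨ cong₂ _*_ (sumF≡sum f) (sumF≡sum g) ⟩
  sum f * sum g                      ≡⟨ *-distribʳ-sum (sum g) f ⟩
  sum (λ a → f a * sum g)            ≡⟨ sum-cong-≗ (λ a → *-distribˡ-sum (f a) g) ⟩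
  sum (λ a → sum (λ b → f a * g b))  ≡⟨ sumF²≡sum² (λ a b → f a * g b) ⟨
  sumF (λ a → sumF (λ b → f a * g b)) ∎

sumF-single : ∀ {n} {f : Fin n → ℕ} (a : Fin n) →
  (∀ b → ¬ b ≡ a → f b ≡ 0) → sumF f ≡ f a
sumF-single {suc n} {f} a vanish = begin
  sumF f                              ≡⟨ sumF≡sum f ⟩
  sum f                               ≡⟨ sum-remove {i = a} f ⟩
  f a + sum (f ∘ punchIn a)           ≡⟨ cong (f a +_) rest≡0 ⟩
  f a + 0                             ≡⟨ +-identityʳ (f a) ⟩
  f a                                 ∎
  where
  rest≡0 : sum (f ∘ punchIn a) ≡ 0
  rest≡0 = trans (sym (sumF≡sum (f ∘ punchIn a)))
    (sumF-zero (λ j → vanish (punchIn a j) (punchInᵢ≢i a j)))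

sumF-↑ : ∀ m {n} (f : Fin (m + n) → ℕ) →
  sumF f ≡ sumF (λ i → f (i ↑ˡ n)) + sumF (λ j → f (m ↑ʳ j))
sumF-↑ zero f = refl
sumF-↑ (suc m) f = trans (cong (f fz +_) (sumF-↑ m (f ∘ fs))) (sym (+-assoc (f fz) _ _))

sumF-combine : ∀ m {n} (f : Fin (m * n) → ℕ) →
  sumF f ≡ sumF (λ i → sumF (λ j → f (combine {m} {n} i j)))
sumF-combine zero f = refl
sumF-combine (suc m) {n} f =
  trans (sumF-↑ n {m * n} f)
        (cong (sumF (λ j → f (j ↑ˡ (m * n))) +_) (sumF-combine m {n} (f ∘ (n ↑ʳ_))))

private
  variable
    a b : Level
    A B : Set a

𝟙-yes : (A? : Dec A) → A → 𝟙 A? ≡ 1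
𝟙-yes (yes _) _ = refl
𝟙-yes (no ¬a) a = ⊥-elim (¬a a)

𝟙-no : (A? : Dec A) → ¬ A → 𝟙 A? ≡ 0
𝟙-no (yes a) ¬a = ⊥-elim (¬a a)
𝟙-no (no _) _ = refl

𝟙-× : (A? : Dec A) (B? : Dec B) → 𝟙 (A? ×-dec B?) ≡ 𝟙 A? * 𝟙 B?
𝟙-× (yes _) (yes _) = refl
𝟙-× (yes _) (no _) = refl
𝟙-× (no _) (yes _) = refl
𝟙-× (no _) (no _) = refl

𝟙-cong : A ⇔ B → (A? : Dec A) (B? : Dec B) → 𝟙 A? ≡ 𝟙 B?
𝟙-cong A⇔B (yes a) B? = sym (𝟙-yes B? (Equivalence.to A⇔B a))
𝟙-cong A⇔B (no ¬a) B? = sym (𝟙-no B? (¬a ∘ Equivalence.from A⇔B))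

sumF-𝟙-unique : ∀ {n p} {P : Fin n → Set p} (P? : ∀ a → Dec (P a)) →
  (∀ {a b} → P a → P b → a ≡ b) → sumF (λ a → 𝟙 (P? a)) ≡ 𝟙 (any? P?)
sumF-𝟙-unique P? unique with any? P?
... | yes (a , pa) =
  trans (sumF-single a (λ b b≢a → 𝟙-no (P? b) (λ pb → b≢a (unique pb pa)))) (𝟙-yes (P? a) pa)
... | no ¬∃ = sumF-zero (λ a → 𝟙-no (P? a) (λ pa → ¬∃ (a , pa)))

module Translates {v : ℕ} (G : FiniteAdditiveGroup v) where
  open FiniteAdditiveGroup G

  abelianGroup : AbelianGroup 0ℓ 0ℓ
  abelianGroup = record { isAbelianGroup = isAbelianGroup }

  open AbelianGroup abelianGroup using (assoc; comm; group)
  open Group group using (_//_; _\\_)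
  open GroupProperties group
    using (∙-cancelˡ; ∙-cancelʳ; ⁻¹-injective; \\-leftDividesˡ; //-rightDividesʳ; x∙y⁻¹≈ε⇒x≈y)
  open import Algebra.Properties.AbelianGroup abelianGroup using (⁻¹-∙-comm)

  //-translate : ∀ p q g → (p +ᴳ g) // (q +ᴳ g) ≡ p // q
  //-translate p q g = begin
    (p +ᴳ g) +ᴳ (-ᴳ (q +ᴳ g))           ≡⟨ cong ((p +ᴳ g) +ᴳ_) (⁻¹-∙-comm q g) ⟨
    (p +ᴳ g) +ᴳ ((-ᴳ q) +ᴳ (-ᴳ g))      ≡⟨ assoc (p +ᴳ g) (-ᴳ q) (-ᴳ g) ⟨
    ((p +ᴳ g) +ᴳ (-ᴳ q)) +ᴳ (-ᴳ g)      ≡⟨ cong (_+ᴳ (-ᴳ g)) swap ⟩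
    ((p +ᴳ (-ᴳ q)) +ᴳ g) +ᴳ (-ᴳ g)      ≡⟨ //-rightDividesʳ g (p // q) ⟩
    p // q                              ∎
    where
    swap : (p +ᴳ g) +ᴳ (-ᴳ q) ≡ (p +ᴳ (-ᴳ q)) +ᴳ g
    swap = begin
      (p +ᴳ g) +ᴳ (-ᴳ q)    ≡⟨ assoc p g (-ᴳ q) ⟩
      p +ᴳ (g +ᴳ (-ᴳ q))    ≡⟨ cong (p +ᴳ_) (comm g (-ᴳ q)) ⟩
      p +ᴳ ((-ᴳ q) +ᴳ g)    ≡⟨ assoc p (-ᴳ q) g ⟨
      (p +ᴳ (-ᴳ q)) +ᴳ g    ∎

  translate-pair⇔ : ∀ p q x y → (∃[ g ] (p +ᴳ g ≡ x × q +ᴳ g ≡ y)) ⇔ (p // q ≡ x // y)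
  translate-pair⇔ p q x y = mk⇔ to from
    where
    to : ∃[ g ] (p +ᴳ g ≡ x × q +ᴳ g ≡ y) → p // q ≡ x // y
    to (g , refl , refl) = sym (//-translate p q g)

    from : p // q ≡ x // y → ∃[ g ] (p +ᴳ g ≡ x × q +ᴳ g ≡ y)
    from e = g , p+g≡x , ⁻¹-injective (∙-cancelˡ x _ _ x//q+g≡x//y)
      where
      g : Fin v
      g = p \\ x
      p+g≡x : p +ᴳ g ≡ x
      p+g≡x = \\-leftDividesˡ p x
      x//q+g≡x//y : x // (q +ᴳ g) ≡ x // y
      x//q+g≡x//y = begin
        x // (q +ᴳ g)           ≡⟨ cong (_// (q +ᴳ g)) p+g≡x ⟨
        (p +ᴳ g) // (q +ᴳ g)    ≡⟨ //-translate p q g ⟩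
        p // q                  ≡⟨ e ⟩
        x // y                  ∎

  _∈?_+_ : ∀ {k} (x : Fin v) (L : Fin k → Fin v) (g : Fin v) → Dec (∃[ s ] (L s +ᴳ g ≡ x))
  x ∈? L + g = any? (λ s → L s +ᴳ g ≟ᶠ x)

  translatesThrough : ∀ {k} → (Fin k → Fin v) → Fin v → Fin v → ℕ
  translatesThrough L x y = sumF (λ g → 𝟙 ((x ∈? L + g) ×-dec (y ∈? L + g)))

  -- For fixed positions a, b of L the translate carrying (L a, L b) to
  -- (x, y) is unique if it exists, and it exists iff a ≠ b and the
  -- differences agree (a ≠ b is forced by x ≠ y).
  translatesOfPair : ∀ {k} (L : Fin k → Fin v) {x y} → ¬ x ≡ y → ∀ a b →
    sumF (λ g → 𝟙 ((L a +ᴳ g ≟ᶠ x) ×-dec (L b +ᴳ g ≟ᶠ y)))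
      ≡ 𝟙 (¬? (a ≟ᶠ b) ×-dec ((L a // L b) ≟ᶠ (x // y)))
  translatesOfPair L {x} {y} x≢y a b =
    trans (sumF-𝟙-unique translateFits? (λ (e , _) (e′ , _) → ∙-cancelˡ (L a) _ _ (trans e (sym e′))))
          (𝟙-cong (mk⇔ to from) (any? translateFits?) (¬? (a ≟ᶠ b) ×-dec (L a // L b ≟ᶠ x // y)))
    where
    translateFits? : ∀ g → Dec (L a +ᴳ g ≡ x × L b +ᴳ g ≡ y)
    translateFits? g = (L a +ᴳ g ≟ᶠ x) ×-dec (L b +ᴳ g ≟ᶠ y)

    to : ∃[ g ] (L a +ᴳ g ≡ x × L b +ᴳ g ≡ y) → ¬ a ≡ b × L a // L b ≡ x // y
    to (g , e , e′) = (λ { refl → x≢y (trans (sym e) e′) }) ,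
                      Equivalence.to (translate-pair⇔ _ _ x y) (g , e , e′)

    from : ¬ a ≡ b × L a // L b ≡ x // y → ∃[ g ] (L a +ᴳ g ≡ x × L b +ᴳ g ≡ y)
    from (_ , e) = Equivalence.from (translate-pair⇔ _ _ x y) e

  translatesThrough≡Δmult : ∀ {k} (L : Fin k → Fin v) → Injective _≡_ _≡_ L →
    ∀ {x y} → ¬ x ≡ y → translatesThrough L x y ≡ Δmult G L (x // y)
  translatesThrough≡Δmult {k} L L-inj {x} {y} x≢y = begin
    sumF (λ g → 𝟙 ((x ∈? L + g) ×-dec (y ∈? L + g)))
      ≡⟨ sumF-cong expand ⟩
    sumF (λ g → sumF (λ a → sumF (λ b → pair g a b)))
      ≡⟨ sumF-comm (λ g a → sumF (pair g a)) ⟩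
    sumF (λ a → sumF (λ g → sumF (λ b → pair g a b)))
      ≡⟨ sumF-cong (λ a → sumF-comm (λ g b → pair g a b)) ⟩
    sumF (λ a → sumF (λ b → sumF (λ g → pair g a b)))
      ≡⟨ sumF-cong (λ a → sumF-cong (λ b → translatesOfPair L x≢y a b)) ⟩
    Δmult G L (x // y)
      ∎
    where
    pair : Fin v → Fin k → Fin k → ℕ
    pair g a b = 𝟙 ((L a +ᴳ g ≟ᶠ x) ×-dec (L b +ᴳ g ≟ᶠ y))

    -- A point occurs at most once in a translate of the injective L.
    count : ∀ g z → 𝟙 (z ∈? L + g) ≡ sumF (λ s → 𝟙 (L s +ᴳ g ≟ᶠ z))
    count g z = sym (sumF-𝟙-unique _ (λ e e′ → L-inj (∙-cancelʳ g _ _ (trans e (sym e′)))))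

    expand : ∀ g → 𝟙 ((x ∈? L + g) ×-dec (y ∈? L + g)) ≡ sumF (λ a → sumF (λ b → pair g a b))
    expand g = begin
      𝟙 ((x ∈? L + g) ×-dec (y ∈? L + g))
        ≡⟨ 𝟙-× (x ∈? L + g) (y ∈? L + g) ⟩
      𝟙 (x ∈? L + g) * 𝟙 (y ∈? L + g)
        ≡⟨ cong₂ _*_ (count g x) (count g y) ⟩
      sumF (λ a → 𝟙 (L a +ᴳ g ≟ᶠ x)) * sumF (λ b → 𝟙 (L b +ᴳ g ≟ᶠ y))
        ≡⟨ sumF-*-sumF (λ a → 𝟙 (L a +ᴳ g ≟ᶠ x)) (λ b → 𝟙 (L b +ᴳ g ≟ᶠ y)) ⟩
      sumF (λ a → sumF (λ b → 𝟙 (L a +ᴳ g ≟ᶠ x) * 𝟙 (L b +ᴳ g ≟ᶠ y)))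
        ≡⟨ sumF-cong (λ a → sumF-cong (λ b → sym (𝟙-× (L a +ᴳ g ≟ᶠ x) (L b +ᴳ g ≟ᶠ y)))) ⟩
      sumF (λ a → sumF (λ b → pair g a b))
        ∎

  development-covers-once : ∀ {k t} (L : Fin t → Fin k → Fin v) →
    IsDifferenceFamily G k 1 L → ∀ {x y} → ¬ x ≡ y →
    sumF (λ i → translatesThrough (L i) x y) ≡ 1
  development-covers-once L (L-inj , Δ≡1) {x} {y} x≢y =
    trans (sumF-cong (λ i → translatesThrough≡Δmult (L i) (L-inj i) x≢y))
          (Δ≡1 (x // y) (x≢y ∘ x∙y⁻¹≈ε⇒x≈y x y))

  IsDifferenceFamily-cong : ∀ {k lam t} {L L′ : Fin t → Fin k → Fin v} →
    (∀ i s → L i s ≡ L′ i s) → IsDifferenceFamily G k lam L → IsDifferenceFamily G k lam L′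
  IsDifferenceFamily-cong {L = L} {L′} L≗L′ (L-inj , Δ≡lam) =
    (λ i e → L-inj i (trans (L≗L′ i _) (trans e (sym (L≗L′ i _))))) ,
    (λ g g≢0 → trans (sym (sumF-cong (λ i → Δmult-cong i g))) (Δ≡lam g g≢0))
    where
    Δmult-cong : ∀ i g → Δmult G (L i) g ≡ Δmult G (L′ i) g
    Δmult-cong i g = sumF-cong (λ a → sumF-cong (λ b → 𝟙-cong
      (mk⇔ (λ (a≢b , e) → a≢b , subst₂ (λ p q → p // q ≡ g) (L≗L′ i a) (L≗L′ i b) e)
           (λ (a≢b , e) → a≢b , subst₂ (λ p q → p // q ≡ g) (sym (L≗L′ i a)) (sym (L≗L′ i b)) e))
      (¬? (a ≟ᶠ b) ×-dec (L i a // L i b ≟ᶠ g)) (¬? (a ≟ᶠ b) ×-dec (L′ i a // L′ i b ≟ᶠ g))))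

-- Line c is {c, c+1, c+3} (mod 7), the translates of the planar
-- difference set {0, 1, 3}; it lists the positions of ℓ_c(B) in B.
fanoLine : Fin 7 → Fin 3 → Fin 7
fanoLine c fz = c
fanoLine c (fs fz) = shift7 c 1
fanoLine c (fs (fs fz)) = shift7 c 3

ℓ≗fanoLine : ∀ {v} (G : FiniteAdditiveGroup v) (B : Fin 7 → Fin v) c s →
  ℓ G B c s ≡ B (fanoLine c s)
ℓ≗fanoLine G B c fz = refl
ℓ≗fanoLine G B c (fs fz) = refl
ℓ≗fanoLine G B c (fs (fs fz)) = refl

fanoLine-inj : ∀ c → Injective _≡_ _≡_ (fanoLine c)
fanoLine-inj c {s} {s′} = from-yes
  (all? λ c → all? λ s → all? λ s′ → (fanoLine c s ≟ᶠ fanoLine c s′) →-dec (s ≟ᶠ s′))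
  c s s′

fano-design : ∀ p q → ¬ p ≡ q →
  sumF (λ c → 𝟙 (any? (λ s → fanoLine c s ≟ᶠ p) ×-dec any? (λ s → fanoLine c s ≟ᶠ q))) ≡ 1
fano-design = from-yes
  (all? λ p → all? λ q → ¬? (p ≟ᶠ q) →-dec
    (sumF (λ c → 𝟙 (any? (λ s → fanoLine c s ≟ᶠ p) ×-dec any? (λ s → fanoLine c s ≟ᶠ q))) ≟ℕ 1))

module Development {v : ℕ} (G : FiniteAdditiveGroup v) {t : ℕ} (F : FKDF G t) where
  open FiniteAdditiveGroup G
  open FKDF F
  open Translates G
  open AbelianGroup abelianGroup using (assoc; group)
  open GroupProperties group using (∙-cancelʳ)

  developedPlane : Fin t → Fin v → ColouredFanoPlane G
  developedPlane i g = record
    { point = λ k → blocks i k +ᴳ g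
    ; point-inj = λ e → proj₁ isDF i (∙-cancelʳ g _ _ e)
    ; line = fanoLine
    ; line-inj = fanoLine-inj
    ; design = fano-design
    }

  developedPlane-translate : ∀ i g h c x →
    OnLine G (developedPlane i g) c x ⇔ OnLine G (developedPlane i (g +ᴳ h)) c (x +ᴳ h)
  developedPlane-translate i g h c x = mk⇔
    (λ (s , e) → s , trans (sym (assoc _ g h)) (cong (_+ᴳ h) e))
    (λ (s , e) → s , ∙-cancelʳ h _ _ (trans (assoc _ g h) e))

  colourClassDF : ∀ c → IsDifferenceFamily G 3 1 (λ i → blocks i ∘ fanoLine c)
  colourClassDF c = IsDifferenceFamily-cong (λ i → ℓ≗fanoLine G (blocks i) c) (linesDF c)

  planes : Fin (t * v) → ColouredFanoPlane G
  planes k = uncurry developedPlane (remQuot {t} v k)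

  covers-once : ∀ x y → ¬ x ≡ y → ∀ c →
    sumF (λ k → 𝟙 (onLine? G (planes k) c x ×-dec onLine? G (planes k) c y)) ≡ 1
  covers-once x y x≢y c = begin
    sumF (λ k → bothOn (planes k))
      ≡⟨ sumF-combine t {v} (bothOn ∘ planes) ⟩
    sumF (λ i → sumF (λ g → bothOn (planes (combine {t} {v} i g))))
      ≡⟨ sumF-cong (λ i → sumF-cong (λ g →
           cong (bothOn ∘ uncurry developedPlane) (remQuot-combine i g))) ⟩
    sumF (λ i → translatesThrough (blocks i ∘ fanoLine c) x y)
      ≡⟨ development-covers-once _ (colourClassDF c) x≢y ⟩
    1 ∎
    where
    bothOn : ColouredFanoPlane G → ℕ
    bothOn P = 𝟙 (onLine? G P c x ×-dec onLine? G P c y)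

  translation-closed : ∀ k h → ∃[ j ] (∀ c x →
    OnLine G (planes k) c x ⇔ OnLine G (planes j) c (x +ᴳ h))
  translation-closed k h = combine i (g +ᴳ h) , λ c x →
    subst (λ p → OnLine G (planes k) c x ⇔ OnLine G (uncurry developedPlane p) c (x +ᴳ h))
          (sym (remQuot-combine i (g +ᴳ h)))
          (developedPlane-translate i g h c x)
    where
    i : Fin t
    i = proj₁ (remQuot {t} v k)
    g : Fin v
    g = proj₂ (remQuot {t} v k)

proposition5 : ∀ {v : ℕ} (G : FiniteAdditiveGroup v) →
    ∃[ t ] (v ≡ 6 * t + 1 × FKDF G t) → GRegularFK G
proposition5 {v} G (t , _ , F) = record
  { m = t * v
  ; planes = planes
  ; kaleidoscope = covers-once
  ; invariant = translation-closed
  }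
  where open Development G F
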